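{- Let $\mathfrak A$ be a J-algebra and $a,b,c,d,u,v,x,y\in A$, and assume $u\le c^{\smile};d$ and $v;y^{\smile}\le a^{\smile};b$. (i) If $c,d$ are functional then $u;v\cdot x;y\le(u;a^{\smile}\cdot x;b^{\smile});(a;v\cdot b;y)$. (ii) If $a,b,c,d$ are functional then $u;v\cdot x;y=(u;a^{\smile}\cdot x;b^{\smile});(a;v\cdot b;y)$.
   Context: A J-algebra is an algebra $\langle A,\cdot,0,1,;,{}^{\smile},1'\rangle$ satisfying for all $x,y,z$: $x\cdot(y\cdot z)=(x\cdot y)\cdot z$, $x\cdot y=y\cdot x$, $x\cdot x=x$, $x;(y;z)=(x;y);z$, $x;1'=x$, $(x\cdot y);z=(x\cdot y);z\cdot y;z$, $x^{\smile\smile}=x$, $(x;y)^{\smile}=y^{\smile};x^{\smile}$, $(x\cdot y)^{\smile}=x^{\smile}\cdot y^{\smile}$, $x;y\cdot z=(z;y^{\smile}\cdot x);(y\cdot x^{\smile};z)\cdot z$, $0\cdot x=0$, $x\cdot1=x$, $x;0=0$. Converse binds tightest, then $;$, then $\cdot$. $x\le y$ means $x\cdot y=x$. An element $p$ is functional if $p^{\smile};p\le1'$. -}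

module Defs where

open import Level using (Level; suc)
open import Relation.Binary.PropositionalEquality using (_≡_)
open import Data.Product using (_×_)

record JAlgebra (ℓ : Level) : Set (suc ℓ) where
  infixl 6 _·_
  infixl 7 _⨟_
  infix 8 _⌣
  infix 4 _≤_
  field
    A    : Set ℓ
    _·_  : A → A → A
    𝟘    : A
    𝟙    : A
    _⨟_  : A → A → A
    _⌣   : A → A
    𝟙'   : A
    ·-assoc  : ∀ x y z → x · (y · z) ≡ (x · y) · z
    ·-comm   : ∀ x y → x · y ≡ y · x
    ·-idem   : ∀ x → x · x ≡ x
    ⨟-assoc  : ∀ x y z → x ⨟ (y ⨟ z) ≡ (x ⨟ y) ⨟ z
    ⨟-idʳ    : ∀ x → x ⨟ 𝟙' ≡ x
    ⨟-mono   : ∀ x y z → (x · y) ⨟ z ≡ (x · y) ⨟ z · y ⨟ z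
    ⌣-invol  : ∀ x → (x ⌣) ⌣ ≡ x
    ⌣-⨟      : ∀ x y → (x ⨟ y) ⌣ ≡ (y ⌣) ⨟ (x ⌣)
    ⌣-·      : ∀ x y → (x · y) ⌣ ≡ (x ⌣) · (y ⌣)
    dedekind : ∀ x y z → x ⨟ y · z ≡ (z ⨟ (y ⌣) · x) ⨟ (y · (x ⌣) ⨟ z) · z
    𝟘-·      : ∀ x → 𝟘 · x ≡ 𝟘
    𝟙-·      : ∀ x → x · 𝟙 ≡ x
    ⨟-𝟘      : ∀ x → x ⨟ 𝟘 ≡ 𝟘

  _≤_ : A → A → Set ℓ
  x ≤ y = x · y ≡ x

  Functional : A → Set ℓ
  Functional p = (p ⌣) ⨟ p ≤ 𝟙'

-- The key move is to replace d by the restriction D = d · c ⨟ u: still u ≤ c⌣ ⨟ D,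
-- D is functional because it lies below d, and D ≤ c ⨟ u lets the functional c cancel
-- at the end.  The modular law then factors D ⨟ v · c ⨟ (x ⨟ y) through
-- G = D ⨟ a⌣ · c ⨟ x ⨟ b⌣ as G ⨟ (b ⨟ y · a ⨟ v), using v ⨟ y⌣ ≤ a⌣ ⨟ b on one side
-- and G⌣ ⨟ D ≤ a on the other.  The reverse inequality in (ii) is cancellation of the
-- functional a and b.
module Submission where

open import Defs
open import Level using (Level)
open import Data.Product using (_×_; _,_)
open import Relation.Binary.Bundles using (Poset)
import Relation.Binary.Reasoning.PartialOrder
open import Relation.Binary.PropositionalEquality
  using (_≡_; refl; sym; trans; cong; cong₂; subst; isEquivalence; module ≡-Reasoning)

module JAlgebraProperties {ℓ : Level} (𝔄 : JAlgebra ℓ) where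
  open JAlgebra 𝔄

  ≤-refl : ∀ {x} → x ≤ x
  ≤-refl {x} = ·-idem x

  ≤-reflexive : ∀ {x y} → x ≡ y → x ≤ y
  ≤-reflexive refl = ≤-refl

  ≤-trans : ∀ {x y z} → x ≤ y → y ≤ z → x ≤ z
  ≤-trans {x} {y} {z} x≤y y≤z = begin
    x · z        ≡⟨ cong (_· z) (sym x≤y) ⟩
    x · y · z    ≡⟨ sym (·-assoc x y z) ⟩
    x · (y · z)  ≡⟨ cong (x ·_) y≤z ⟩
    x · y        ≡⟨ x≤y ⟩
    x            ∎
    where open ≡-Reasoning

  ≤-antisym : ∀ {x y} → x ≤ y → y ≤ x → x ≡ y
  ≤-antisym {x} {y} x≤y y≤x = trans (sym x≤y) (trans (·-comm x y) y≤x)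

  ≤-poset : Poset ℓ ℓ ℓ
  ≤-poset = record
    { Carrier = A
    ; _≈_ = _≡_
    ; _≤_ = _≤_
    ; isPartialOrder = record
      { isPreorder = record
        { isEquivalence = isEquivalence
        ; reflexive = ≤-reflexive
        ; trans = ≤-trans
        }
      ; antisym = ≤-antisym
      }
    }

  module ≤-Reasoning = Relation.Binary.Reasoning.PartialOrder ≤-poset

  x·y≤x : ∀ {x y} → x · y ≤ x
  x·y≤x {x} {y} = trans (sym (·-assoc x y x))
    (trans (cong (x ·_) (·-comm y x)) (trans (·-assoc x x y) (cong (_· y) (·-idem x))))

  x·y≤y : ∀ {x y} → x · y ≤ y
  x·y≤y {x} {y} = trans (sym (·-assoc x y y)) (cong (x ·_) (·-idem y))

  ·-greatest : ∀ {x y z} → z ≤ x → z ≤ y → z ≤ x · y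
  ·-greatest {x} {y} {z} z≤x z≤y = trans (·-assoc z x y) (trans (cong (_· y) z≤x) z≤y)

  ·-mono-≤ : ∀ {x x′ y y′} → x ≤ x′ → y ≤ y′ → x · y ≤ x′ · y′
  ·-mono-≤ x≤x′ y≤y′ = ·-greatest (≤-trans x·y≤x x≤x′) (≤-trans x·y≤y y≤y′)

  ⨟-monoˡ-≤ : ∀ {x y} z → x ≤ y → x ⨟ z ≤ y ⨟ z
  ⨟-monoˡ-≤ {x} {y} z x≤y = sym (subst (λ t → t ⨟ z ≡ t ⨟ z · y ⨟ z) x≤y (⨟-mono x y z))

  ⌣-mono-≤ : ∀ {x y} → x ≤ y → x ⌣ ≤ y ⌣
  ⌣-mono-≤ {x} {y} x≤y = trans (sym (⌣-· x y)) (cong _⌣ x≤y)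

  ⌣-⨟-⌣ : ∀ x z → ((x ⌣) ⨟ (z ⌣)) ⌣ ≡ z ⨟ x
  ⌣-⨟-⌣ x z = trans (⌣-⨟ (x ⌣) (z ⌣)) (cong₂ _⨟_ (⌣-invol z) (⌣-invol x))

  -- Right monotonicity is not an axiom; it is left monotonicity conjugated by ⌣.
  ⨟-monoʳ-≤ : ∀ {x y} z → x ≤ y → z ⨟ x ≤ z ⨟ y
  ⨟-monoʳ-≤ {x} {y} z x≤y = begin
    z ⨟ x                   ≡⟨ sym (⌣-⨟-⌣ x z) ⟩
    ((x ⌣) ⨟ (z ⌣)) ⌣       ≤⟨ ⌣-mono-≤ (⨟-monoˡ-≤ (z ⌣) (⌣-mono-≤ x≤y)) ⟩
    ((y ⌣) ⨟ (z ⌣)) ⌣       ≡⟨ ⌣-⨟-⌣ y z ⟩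
    z ⨟ y                   ∎
    where open ≤-Reasoning

  ⨟-mono-≤ : ∀ {x x′ y y′} → x ≤ x′ → y ≤ y′ → x ⨟ y ≤ x′ ⨟ y′
  ⨟-mono-≤ {x′ = x′} {y = y} x≤x′ y≤y′ = ≤-trans (⨟-monoˡ-≤ y x≤x′) (⨟-monoʳ-≤ x′ y≤y′)

  𝟙'⌣≡𝟙' : 𝟙' ⌣ ≡ 𝟙'
  𝟙'⌣≡𝟙' = sym (begin
    𝟙'                      ≡⟨ sym (⌣-invol 𝟙') ⟩
    (𝟙' ⌣) ⌣                ≡⟨ cong _⌣ (sym (⨟-idʳ (𝟙' ⌣))) ⟩
    ((𝟙' ⌣) ⨟ 𝟙') ⌣         ≡⟨ ⌣-⨟ (𝟙' ⌣) 𝟙' ⟩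
    (𝟙' ⌣) ⨟ ((𝟙' ⌣) ⌣)     ≡⟨ cong ((𝟙' ⌣) ⨟_) (⌣-invol 𝟙') ⟩
    (𝟙' ⌣) ⨟ 𝟙'             ≡⟨ ⨟-idʳ (𝟙' ⌣) ⟩
    𝟙' ⌣                    ∎)
    where open ≡-Reasoning

  ⨟-idˡ : ∀ x → 𝟙' ⨟ x ≡ x
  ⨟-idˡ x = begin
    𝟙' ⨟ x                  ≡⟨ cong₂ _⨟_ (sym 𝟙'⌣≡𝟙') (sym (⌣-invol x)) ⟩
    (𝟙' ⌣) ⨟ ((x ⌣) ⌣)      ≡⟨ sym (⌣-⨟ (x ⌣) 𝟙') ⟩
    ((x ⌣) ⨟ 𝟙') ⌣          ≡⟨ cong _⌣ (⨟-idʳ (x ⌣)) ⟩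
    (x ⌣) ⌣                 ≡⟨ ⌣-invol x ⟩
    x                       ∎
    where open ≡-Reasoning

  modular : ∀ x y z → x ⨟ y · z ≤ (x · z ⨟ (y ⌣)) ⨟ (y · (x ⌣) ⨟ z)
  modular x y z = begin
    x ⨟ y · z                                       ≡⟨ dedekind x y z ⟩
    (z ⨟ (y ⌣) · x) ⨟ (y · (x ⌣) ⨟ z) · z          ≤⟨ x·y≤x ⟩
    (z ⨟ (y ⌣) · x) ⨟ (y · (x ⌣) ⨟ z)              ≡⟨ cong (λ t → t ⨟ (y · (x ⌣) ⨟ z)) (·-comm (z ⨟ (y ⌣)) x) ⟩
    (x · z ⨟ (y ⌣)) ⨟ (y · (x ⌣) ⨟ z)              ∎
    where open ≤-Reasoning

  modularˡ : ∀ x y z → x ⨟ y · z ≤ (x · z ⨟ (y ⌣)) ⨟ y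
  modularˡ x y z = ≤-trans (modular x y z) (⨟-monoʳ-≤ (x · z ⨟ (y ⌣)) x·y≤x)

  modularʳ : ∀ x y z → x ⨟ y · z ≤ x ⨟ (y · (x ⌣) ⨟ z)
  modularʳ x y z = ≤-trans (modular x y z) (⨟-monoˡ-≤ (y · (x ⌣) ⨟ z) x·y≤x)

  ≤⨟-restrict : ∀ {u x y} → u ≤ x ⨟ y → u ≤ x ⨟ (y · (x ⌣) ⨟ u)
  ≤⨟-restrict {u} {x} {y} u≤xy = ≤-trans (·-greatest u≤xy ≤-refl) (modularʳ x y u)

  functional-cancel : ∀ {c} x → Functional c → (c ⌣) ⨟ (c ⨟ x) ≤ x
  functional-cancel {c} x fc = begin
    (c ⌣) ⨟ (c ⨟ x)         ≡⟨ ⨟-assoc (c ⌣) c x ⟩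
    (c ⌣) ⨟ c ⨟ x           ≤⟨ ⨟-monoˡ-≤ x fc ⟩
    𝟙' ⨟ x                  ≡⟨ ⨟-idˡ x ⟩
    x                       ∎
    where open ≤-Reasoning

  functional-≤ : ∀ {x p} → x ≤ p → Functional p → Functional x
  functional-≤ {x} {p} x≤p fp = begin
    (x ⌣) ⨟ x               ≤⟨ ⨟-monoˡ-≤ x (⌣-mono-≤ x≤p) ⟩
    (p ⌣) ⨟ x               ≤⟨ ⨟-monoʳ-≤ (p ⌣) x≤p ⟩
    (p ⌣) ⨟ p               ≤⟨ fp ⟩
    𝟙'                      ∎
    where open ≤-Reasoning

  functional-⨟-cancel : ∀ {p} s t → Functional p → s ⨟ p ⌣ ⨟ (p ⨟ t) ≤ s ⨟ t
  functional-⨟-cancel {p} s t fp = begin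
    s ⨟ p ⌣ ⨟ (p ⨟ t)       ≡⟨ sym (⨟-assoc s (p ⌣) (p ⨟ t)) ⟩
    s ⨟ (p ⌣ ⨟ (p ⨟ t))     ≤⟨ ⨟-monoʳ-≤ s (functional-cancel t fp) ⟩
    s ⨟ t                   ∎
    where open ≤-Reasoning

  ⨟-meet-≤-factorisation : ∀ {a b c d u v x y} →
    u ≤ c ⌣ ⨟ d → v ⨟ y ⌣ ≤ a ⌣ ⨟ b → Functional c → Functional d →
    u ⨟ v · x ⨟ y ≤ (u ⨟ a ⌣ · x ⨟ b ⌣) ⨟ (a ⨟ v · b ⨟ y)
  ⨟-meet-≤-factorisation {a} {b} {c} {d} {u} {v} {x} {y} u≤c⌣d vy⌣≤a⌣b fc fd = begin
    u ⨟ v · x ⨟ y                                ≤⟨ ·-mono-≤ (⨟-monoˡ-≤ v u≤c⌣D) ≤-refl ⟩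
    c ⌣ ⨟ D ⨟ v · x ⨟ y                          ≡⟨ cong (_· x ⨟ y) (sym (⨟-assoc (c ⌣) D v)) ⟩
    c ⌣ ⨟ (D ⨟ v) · x ⨟ y                        ≤⟨ modularʳ (c ⌣) (D ⨟ v) (x ⨟ y) ⟩
    c ⌣ ⨟ (D ⨟ v · c ⌣ ⌣ ⨟ (x ⨟ y))              ≡⟨ cong (λ t → c ⌣ ⨟ (D ⨟ v · t ⨟ (x ⨟ y))) (⌣-invol c) ⟩
    c ⌣ ⨟ (D ⨟ v · c ⨟ (x ⨟ y))                  ≤⟨ ⨟-monoʳ-≤ (c ⌣) (·-greatest Dv·cxy≤Gby x·y≤x) ⟩
    c ⌣ ⨟ (G ⨟ (b ⨟ y) · D ⨟ v)                  ≤⟨ ⨟-monoʳ-≤ (c ⌣) (modularʳ G (b ⨟ y) (D ⨟ v)) ⟩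
    c ⌣ ⨟ (G ⨟ (b ⨟ y · G ⌣ ⨟ (D ⨟ v)))          ≤⟨ ⨟-monoʳ-≤ (c ⌣) (⨟-monoʳ-≤ G (·-mono-≤ ≤-refl G⌣Dv≤av)) ⟩
    c ⌣ ⨟ (G ⨟ (b ⨟ y · a ⨟ v))                  ≡⟨ ⨟-assoc (c ⌣) G (b ⨟ y · a ⨟ v) ⟩
    c ⌣ ⨟ G ⨟ (b ⨟ y · a ⨟ v)                    ≤⟨ ⨟-mono-≤ c⌣G≤ua⌣·xb⌣ (≤-reflexive (·-comm (b ⨟ y) (a ⨟ v))) ⟩
    (u ⨟ a ⌣ · x ⨟ b ⌣) ⨟ (a ⨟ v · b ⨟ y)        ∎
    where
    open ≤-Reasoning

    D : A
    D = d · c ⨟ u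

    G : A
    G = D ⨟ a ⌣ · c ⨟ x ⨟ b ⌣

    u≤c⌣D : u ≤ c ⌣ ⨟ D
    u≤c⌣D = subst (λ t → u ≤ c ⌣ ⨟ (d · t ⨟ u)) (⌣-invol c) (≤⨟-restrict u≤c⌣d)

    Dv·cxy≤Gby : D ⨟ v · c ⨟ (x ⨟ y) ≤ G ⨟ (b ⨟ y)
    Dv·cxy≤Gby = begin
      D ⨟ v · c ⨟ (x ⨟ y)                        ≡⟨ trans (·-comm (D ⨟ v) _) (cong (_· D ⨟ v) (⨟-assoc c x y)) ⟩
      c ⨟ x ⨟ y · D ⨟ v                          ≤⟨ modularˡ (c ⨟ x) y (D ⨟ v) ⟩
      (c ⨟ x · D ⨟ v ⨟ y ⌣) ⨟ y                  ≡⟨ cong (λ t → (c ⨟ x · t) ⨟ y) (sym (⨟-assoc D v (y ⌣))) ⟩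
      (c ⨟ x · D ⨟ (v ⨟ y ⌣)) ⨟ y                ≤⟨ ⨟-monoˡ-≤ y (·-mono-≤ ≤-refl (⨟-monoʳ-≤ D vy⌣≤a⌣b)) ⟩
      (c ⨟ x · D ⨟ (a ⌣ ⨟ b)) ⨟ y                ≡⟨ cong (_⨟ y) (trans (cong (c ⨟ x ·_) (⨟-assoc D (a ⌣) b)) (·-comm (c ⨟ x) _)) ⟩
      (D ⨟ a ⌣ ⨟ b · c ⨟ x) ⨟ y                  ≤⟨ ⨟-monoˡ-≤ y (modularˡ (D ⨟ a ⌣) b (c ⨟ x)) ⟩
      G ⨟ b ⨟ y                                  ≡⟨ sym (⨟-assoc G b y) ⟩
      G ⨟ (b ⨟ y)                                ∎

    G⌣≤aD⌣ : G ⌣ ≤ a ⨟ D ⌣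
    G⌣≤aD⌣ = begin
      G ⌣                                        ≤⟨ ⌣-mono-≤ x·y≤x ⟩
      (D ⨟ a ⌣) ⌣                                ≡⟨ ⌣-⨟ D (a ⌣) ⟩
      a ⌣ ⌣ ⨟ D ⌣                                ≡⟨ cong (_⨟ D ⌣) (⌣-invol a) ⟩
      a ⨟ D ⌣                                    ∎

    G⌣Dv≤av : G ⌣ ⨟ (D ⨟ v) ≤ a ⨟ v
    G⌣Dv≤av = begin
      G ⌣ ⨟ (D ⨟ v)                              ≡⟨ ⨟-assoc (G ⌣) D v ⟩
      G ⌣ ⨟ D ⨟ v                                ≤⟨ ⨟-monoˡ-≤ v (⨟-monoˡ-≤ D G⌣≤aD⌣) ⟩
      a ⨟ D ⌣ ⨟ D ⨟ v                            ≡⟨ cong (_⨟ v) (sym (⨟-assoc a (D ⌣) D)) ⟩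
      a ⨟ (D ⌣ ⨟ D) ⨟ v                          ≤⟨ ⨟-monoˡ-≤ v (⨟-monoʳ-≤ a (functional-≤ x·y≤x fd)) ⟩
      a ⨟ 𝟙' ⨟ v                                 ≡⟨ cong (_⨟ v) (⨟-idʳ a) ⟩
      a ⨟ v                                      ∎

    c⌣G≤ua⌣·xb⌣ : c ⌣ ⨟ G ≤ u ⨟ a ⌣ · x ⨟ b ⌣
    c⌣G≤ua⌣·xb⌣ = ·-greatest
      (begin
        c ⌣ ⨟ G                                  ≤⟨ ⨟-monoʳ-≤ (c ⌣) (≤-trans x·y≤x (⨟-monoˡ-≤ (a ⌣) x·y≤y)) ⟩
        c ⌣ ⨟ (c ⨟ u ⨟ a ⌣)                      ≡⟨ cong (c ⌣ ⨟_) (sym (⨟-assoc c u (a ⌣))) ⟩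
        c ⌣ ⨟ (c ⨟ (u ⨟ a ⌣))                    ≤⟨ functional-cancel (u ⨟ a ⌣) fc ⟩
        u ⨟ a ⌣                                  ∎)
      (begin
        c ⌣ ⨟ G                                  ≤⟨ ⨟-monoʳ-≤ (c ⌣) x·y≤y ⟩
        c ⌣ ⨟ (c ⨟ x ⨟ b ⌣)                      ≡⟨ cong (c ⌣ ⨟_) (sym (⨟-assoc c x (b ⌣))) ⟩
        c ⌣ ⨟ (c ⨟ (x ⨟ b ⌣))                    ≤⟨ functional-cancel (x ⨟ b ⌣) fc ⟩
        x ⨟ b ⌣                                  ∎)

  factorisation-≤-⨟-meet : ∀ {a b} u v x y → Functional a → Functional b →
    (u ⨟ a ⌣ · x ⨟ b ⌣) ⨟ (a ⨟ v · b ⨟ y) ≤ u ⨟ v · x ⨟ y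
  factorisation-≤-⨟-meet u v x y fa fb = ·-greatest
    (≤-trans (⨟-mono-≤ x·y≤x x·y≤x) (functional-⨟-cancel u v fa))
    (≤-trans (⨟-mono-≤ x·y≤y x·y≤y) (functional-⨟-cancel x y fb))

proposition58 : ∀ {ℓ : Level} (𝔄 : JAlgebra ℓ) → let open JAlgebra 𝔄 in
    ∀ (a b c d u v x y : A) →
    u ≤ (c ⌣) ⨟ d → v ⨟ (y ⌣) ≤ (a ⌣) ⨟ b →
    ((Functional c → Functional d →
        u ⨟ v · x ⨟ y ≤ (u ⨟ (a ⌣) · x ⨟ (b ⌣)) ⨟ (a ⨟ v · b ⨟ y))
    × (Functional a → Functional b → Functional c → Functional d →
        u ⨟ v · x ⨟ y ≡ (u ⨟ (a ⌣) · x ⨟ (b ⌣)) ⨟ (a ⨟ v · b ⨟ y)))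
proposition58 𝔄 a b c d u v x y u≤c⌣d vy⌣≤a⌣b =
  (λ fc fd → ⨟-meet-≤-factorisation u≤c⌣d vy⌣≤a⌣b fc fd) ,
  (λ fa fb fc fd → ≤-antisym (⨟-meet-≤-factorisation u≤c⌣d vy⌣≤a⌣b fc fd)
                             (factorisation-≤-⨟-meet u v x y fa fb))
  where open JAlgebraProperties 𝔄
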